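{- Let $n\ge1$ and let $T:S_n\to S_n$, $T(w)=w\cdot t_{1,w(1)}$. Then $T$ sorts $w\in S_n$ if and only if $w$ is a single cycle containing $1$, i.e. $w=(i_1,i_2,\dots,i_k)$ for some distinct $i_1,\dots,i_k\in[n]$ with $i_1=1$.
   Context: $[n]=\{1,\dots,n\}$, $S_n$ is the group of bijections $[n]\to[n]$ with product $(ab)(i)=a(b(i))$ and identity $\varepsilon$. $t_{1,k}$ is the transposition of $1$ and $k$ (the identity if $k=1$); $(i_1,\dots,i_k)$ denotes a cycle (for $k=1$ the identity). $T$ sorts $w$ if $T^m(w)=\varepsilon$ for some $m\in\mathbb{N}$, $T^m$ the $m$-th iterate. -}

module Defs where

open import Data.Nat using (ℕ; zero; suc)
open import Data.Fin using (Fin; _≟_)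
open import Data.Fin.Permutation using (Permutation′; _⟨$⟩ʳ_; _∘ₚ_; transpose; id)
open import Data.List using (List; []; _∷_)
open import Data.List.Relation.Unary.Unique.Propositional using (Unique)
open import Data.Product using (∃; _×_)
open import Relation.Binary.PropositionalEquality using (_≡_)
open import Relation.Nullary using (yes; no)

-- [n] is modelled by Fin n (element i ∈ [n] is Fin index i-1; so 1 is `zero`).
-- S_n = Permutation′ n;  w i  is written  w ⟨$⟩ʳ i.

_≈ₚ_ : ∀ {n} → Permutation′ n → Permutation′ n → Set
_≈ₚ_ {n} a b = ∀ (i : Fin n) → a ⟨$⟩ʳ i ≡ b ⟨$⟩ʳ i

-- Product (a b)(i) = a (b i).  (stdlib: (π₁ ∘ₚ π₂) ⟨$⟩ʳ i = π₂ ⟨$⟩ʳ (π₁ ⟨$⟩ʳ i).)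
_·_ : ∀ {n} → Permutation′ n → Permutation′ n → Permutation′ n
a · b = b ∘ₚ a

t1 : ∀ {n} → Fin (suc n) → Permutation′ (suc n)
t1 k = transpose Fin.zero k

T : ∀ {n} → Permutation′ (suc n) → Permutation′ (suc n)
T w = w · t1 (w ⟨$⟩ʳ Fin.zero)

iterate : ∀ {A : Set} → (A → A) → ℕ → A → A
iterate f zero x = x
iterate f (suc m) x = f (iterate f m x)

Sorts : ∀ {n} → (Permutation′ (suc n) → Permutation′ (suc n)) → Permutation′ (suc n) → Set
Sorts F w = ∃ λ m → iterate F m w ≈ₚ id

-- The function underlying the cycle (i₁, …, i_k): i_j ↦ i_{j+1}, i_k ↦ i₁,
-- everything else fixed (for k ≤ 1 it is the identity).
-- cycleNext first a rest x: x's image in the cycle segment a, rest…, closing back to first.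
cycleNext : ∀ {n} → Fin n → Fin n → List (Fin n) → Fin n → Fin n
cycleNext first a [] x with x ≟ a
... | yes _ = first
... | no  _ = x
cycleNext first a (b ∷ rest) x with x ≟ a
... | yes _ = b
... | no  _ = cycleNext first b rest x

cycleFun : ∀ {n} → List (Fin n) → Fin n → Fin n
cycleFun [] x = x
cycleFun (a ∷ rest) x = cycleNext a a rest x

IsCycle : ∀ {n} → Permutation′ n → List (Fin n) → Set
IsCycle {n} w is = Unique is × (∀ (x : Fin n) → w ⟨$⟩ʳ x ≡ cycleFun is x)

{-# OPTIONS --safe #-}
module Submission where

open import Defs
open import Data.Nat using (ℕ; zero; suc)
open import Data.Fin using (Fin; _≟_)
open import Data.Fin.Patterns using (0F)
open import Data.Fin.Permutation using (Permutation′; _⟨$⟩ʳ_; id)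
import Data.Fin.Permutation.Components as PC
open import Data.List using (List; []; _∷_; head)
open import Data.List.Relation.Unary.All using (All; []; _∷_)
open import Data.List.Relation.Unary.AllPairs using ([]; _∷_)
open import Data.List.Relation.Unary.Unique.Propositional using (Unique)
open import Data.Empty using (⊥-elim)
open import Data.Maybe using (fromMaybe)
open import Data.Product using (∃; _,_)
open import Function.Bundles using (_⇔_; mk⇔)
open import Relation.Binary.PropositionalEquality
  using (_≡_; _≢_; refl; sym; trans; cong; ≢-sym; module ≡-Reasoning)
open import Relation.Nullary using (yes; no)
open import Relation.Nullary.Decidable using (dec-true; dec-false; dec-no)

open ≡-Reasoning

-- If w(1) = b ≠ 1, then T(w) = w·(1 b) fixes b, and (1 b i₃ … iₖ)·(1 b) = (1 i₃ … iₖ);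
-- if w(1) = 1, then T(w) = w.  So T strips the second entry off a cycle through 1, and
-- conversely w = T(w)·(1 b) is a cycle through 1 whenever T(w) is one, b being a fixed
-- point of T(w) and hence absent from its cycle.  Induction on the length of the cycle,
-- resp. on the number of iterations, gives the two directions.

module _ {n : ℕ} where

  transpose-matchˡ : (i j : Fin n) → PC.transpose i j i ≡ j
  transpose-matchˡ i j rewrite dec-true (i ≟ i) refl = refl

  transpose-matchʳ : (i j : Fin n) → PC.transpose i j j ≡ i
  transpose-matchʳ i j with i ≟ j
  ... | yes refl = transpose-matchˡ i i
  ... | no i≢j rewrite dec-false (j ≟ i) (≢-sym i≢j) | dec-true (j ≟ j) refl = refl

  transpose-mismatch : (i j : Fin n) {k : Fin n} → k ≢ i → k ≢ j → PC.transpose i j k ≡ k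
  transpose-mismatch i j {k} k≢i k≢j rewrite dec-false (k ≟ i) k≢i | dec-false (k ≟ j) k≢j = refl

  transpose-self : (i k : Fin n) → PC.transpose i i k ≡ k
  transpose-self i k with i ≟ k
  ... | yes refl = transpose-matchˡ i i
  ... | no i≢k = transpose-mismatch i i (≢-sym i≢k) (≢-sym i≢k)

  transpose-involutive : (i j k : Fin n) → PC.transpose i j (PC.transpose i j k) ≡ k
  transpose-involutive i j k with i ≟ k | j ≟ k
  ... | yes refl | _ = trans (cong (PC.transpose i j) (transpose-matchˡ i j)) (transpose-matchʳ i j)
  ... | no _ | yes refl = trans (cong (PC.transpose i j) (transpose-matchʳ i j)) (transpose-matchˡ i j)
  ... | no i≢k | no j≢k = trans (cong (PC.transpose i j) k-fixed) k-fixed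
    where
    k-fixed : PC.transpose i j k ≡ k
    k-fixed = transpose-mismatch i j (≢-sym i≢k) (≢-sym j≢k)

  cycleNext-here : (f a : Fin n) (r : List (Fin n)) → cycleNext f a r a ≡ fromMaybe f (head r)
  cycleNext-here f a [] with a ≟ a
  ... | yes _ = refl
  ... | no a≢a = ⊥-elim (a≢a refl)
  cycleNext-here f a (b ∷ r) with a ≟ a
  ... | yes _ = refl
  ... | no a≢a = ⊥-elim (a≢a refl)

  cycleNext-skip : (f a b : Fin n) (r : List (Fin n)) {x : Fin n} → x ≢ a →
                   cycleNext f a (b ∷ r) x ≡ cycleNext f b r x
  cycleNext-skip f a b r {x} x≢a rewrite dec-no (x ≟ a) x≢a = refl

  cycleNext-drop : (f a b : Fin n) (r : List (Fin n)) {x : Fin n} → x ≢ a → x ≢ b →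
                   cycleNext f a (b ∷ r) x ≡ cycleNext f a r x
  cycleNext-drop f a b [] {x} x≢a x≢b rewrite dec-no (x ≟ a) x≢a | dec-no (x ≟ b) x≢b = refl
  cycleNext-drop f a b (c ∷ r) {x} x≢a x≢b rewrite dec-no (x ≟ a) x≢a | dec-no (x ≟ b) x≢b = refl

  cycleNext-fresh : (f a : Fin n) (r : List (Fin n)) {x : Fin n} → All (x ≢_) (a ∷ r) →
                    cycleNext f a r x ≡ x
  cycleNext-fresh f a [] {x} (x≢a ∷ []) rewrite dec-no (x ≟ a) x≢a = refl
  cycleNext-fresh f a (b ∷ r) {x} (x≢a ∷ x∉r) =
    trans (cycleNext-skip f a b r x≢a) (cycleNext-fresh f b r x∉r)

  cycleNext-fixed⇒fresh : (f a : Fin n) (r : List (Fin n)) {x : Fin n} → Unique (a ∷ r) →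
                          x ≢ f → cycleNext f a r x ≡ x → All (x ≢_) (a ∷ r)
  cycleNext-fixed⇒fresh f a [] {x} _ x≢f fixed with x ≟ a
  ... | yes _ = ⊥-elim (x≢f (sym fixed))
  ... | no x≢a = x≢a ∷ []
  cycleNext-fixed⇒fresh f a (b ∷ r) {x} ((a≢b ∷ _) ∷ b∷r-unique) x≢f fixed with x ≟ a
  ... | yes x≡a = ⊥-elim (a≢b (trans (sym x≡a) (sym fixed)))
  ... | no x≢a = x≢a ∷ cycleNext-fixed⇒fresh f b r b∷r-unique x≢f fixed

  cycleFun-singleton : (a x : Fin n) → cycleFun (a ∷ []) x ≡ x
  cycleFun-singleton a x with x ≟ a
  ... | yes x≡a = sym x≡a
  ... | no _ = refl

  cycleFun-fixed⇒fresh : (a : Fin n) (r : List (Fin n)) {x : Fin n} → Unique (a ∷ r) →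
                         x ≢ a → cycleFun (a ∷ r) x ≡ x → All (x ≢_) r
  cycleFun-fixed⇒fresh a r unique x≢a fixed with cycleNext-fixed⇒fresh a a r unique x≢a fixed
  ... | _ ∷ x∉r = x∉r

  cycleFun-∷-transpose : (a b : Fin n) (r : List (Fin n)) → b ≢ a → All (b ≢_) r →
                         ∀ x → cycleFun (a ∷ b ∷ r) x ≡ cycleFun (a ∷ r) (PC.transpose a b x)
  cycleFun-∷-transpose a b r b≢a b∉r x with a ≟ x | b ≟ x
  ... | yes refl | _ = begin
    cycleNext a a (b ∷ r) a                ≡⟨ cycleNext-here a a (b ∷ r) ⟩
    b                                      ≡⟨ sym (cycleNext-fresh a a r (b≢a ∷ b∉r)) ⟩
    cycleNext a a r b                      ≡⟨ cong (cycleNext a a r) (transpose-matchˡ a b) ⟨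
    cycleNext a a r (PC.transpose a b a)   ∎
  ... | no _ | yes refl = begin
    cycleNext a a (b ∷ r) b                ≡⟨ cycleNext-skip a a b r b≢a ⟩
    cycleNext a b r b                      ≡⟨ cycleNext-here a b r ⟩
    fromMaybe a (head r)                   ≡⟨ cycleNext-here a a r ⟨
    cycleNext a a r a                      ≡⟨ cong (cycleNext a a r) (transpose-matchʳ a b) ⟨
    cycleNext a a r (PC.transpose a b b)   ∎
  ... | no a≢x | no b≢x = begin
    cycleNext a a (b ∷ r) x                ≡⟨ cycleNext-drop a a b r (≢-sym a≢x) (≢-sym b≢x) ⟩
    cycleNext a a r x                      ≡⟨ cong (cycleNext a a r) x-fixed ⟨
    cycleNext a a r (PC.transpose a b x)   ∎
    where
    x-fixed : PC.transpose a b x ≡ x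
    x-fixed = transpose-mismatch a b (≢-sym a≢x) (≢-sym b≢x)

iterate-suc′ : ∀ {A : Set} (f : A → A) (m : ℕ) (x : A) → iterate f (suc m) x ≡ iterate f m (f x)
iterate-suc′ f zero x = refl
iterate-suc′ f (suc m) x = cong f (iterate-suc′ f m x)

module _ {n : ℕ} where

  Sorts-step : {F : Permutation′ (suc n) → Permutation′ (suc n)} {w : Permutation′ (suc n)} →
               Sorts F (F w) → Sorts F w
  Sorts-step {F} {w} (m , sorted) =
    suc m , λ x → trans (cong (_⟨$⟩ʳ x) (iterate-suc′ F m w)) (sorted x)

  T-fixed : (w : Permutation′ (suc n)) → w ⟨$⟩ʳ 0F ≡ 0F → T w ≈ₚ w
  T-fixed w w1≡1 x = begin
    T w ⟨$⟩ʳ x                             ≡⟨⟩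
    w ⟨$⟩ʳ PC.transpose 0F (w ⟨$⟩ʳ 0F) x   ≡⟨ cong (λ b → w ⟨$⟩ʳ PC.transpose 0F b x) w1≡1 ⟩
    w ⟨$⟩ʳ PC.transpose 0F 0F x            ≡⟨ cong (w ⟨$⟩ʳ_) (transpose-self 0F x) ⟩
    w ⟨$⟩ʳ x                               ∎

  T-fixes-image-of-1 : (w : Permutation′ (suc n)) → T w ⟨$⟩ʳ (w ⟨$⟩ʳ 0F) ≡ w ⟨$⟩ʳ 0F
  T-fixes-image-of-1 w = cong (w ⟨$⟩ʳ_) (transpose-matchʳ 0F (w ⟨$⟩ʳ 0F))

  T-shortens-cycle : (w : Permutation′ (suc n)) (b : Fin (suc n)) (r : List (Fin (suc n))) →
                     IsCycle w (0F ∷ b ∷ r) → IsCycle (T w) (0F ∷ r)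
  T-shortens-cycle w b r (((1≢b ∷ 1∉r) ∷ (b∉r ∷ r-unique)) , w≗cycle) =
    (1∉r ∷ r-unique) , λ x → begin
      T w ⟨$⟩ʳ x                        ≡⟨⟩
      w ⟨$⟩ʳ PC.transpose 0F (w ⟨$⟩ʳ 0F) x
                                        ≡⟨ cong (λ c → w ⟨$⟩ʳ PC.transpose 0F c x) w1≡b ⟩
      w ⟨$⟩ʳ t x                        ≡⟨ w≗cycle (t x) ⟩
      cycleFun (0F ∷ b ∷ r) (t x)       ≡⟨ cycleFun-∷-transpose 0F b r (≢-sym 1≢b) b∉r (t x) ⟩
      cycleFun (0F ∷ r) (t (t x))       ≡⟨ cong (cycleFun (0F ∷ r)) (transpose-involutive 0F b x) ⟩
      cycleFun (0F ∷ r) x               ∎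
    where
    t : Fin (suc n) → Fin (suc n)
    t = PC.transpose 0F b
    w1≡b : w ⟨$⟩ʳ 0F ≡ b
    w1≡b = trans (w≗cycle 0F) (cycleNext-here 0F 0F (b ∷ r))

  T-reflects-cycle : (w : Permutation′ (suc n)) →
                     ∃ (λ r → IsCycle (T w) (0F ∷ r)) → ∃ λ rest → IsCycle w (0F ∷ rest)
  T-reflects-cycle w (r , unique@(1∉r ∷ r-unique) , Tw≗cycle) with w ⟨$⟩ʳ 0F ≟ 0F
  ... | yes w1≡1 = r , unique , λ x → trans (sym (T-fixed w w1≡1 x)) (Tw≗cycle x)
  ... | no w1≢1 = b ∷ r , ((≢-sym w1≢1 ∷ 1∉r) ∷ (b∉r ∷ r-unique)) , λ x → begin
    w ⟨$⟩ʳ x                   ≡⟨ cong (w ⟨$⟩ʳ_) (transpose-involutive 0F b x) ⟨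
    T w ⟨$⟩ʳ t x               ≡⟨ Tw≗cycle (t x) ⟩
    cycleFun (0F ∷ r) (t x)    ≡⟨ cycleFun-∷-transpose 0F b r w1≢1 b∉r x ⟨
    cycleFun (0F ∷ b ∷ r) x    ∎
    where
    b : Fin (suc n)
    b = w ⟨$⟩ʳ 0F
    t : Fin (suc n) → Fin (suc n)
    t = PC.transpose 0F b
    b∉r : All (b ≢_) r
    b∉r = cycleFun-fixed⇒fresh 0F r unique w1≢1 (trans (sym (Tw≗cycle b)) (T-fixes-image-of-1 w))

  sorted⇒cycle : (m : ℕ) (w : Permutation′ (suc n)) → iterate T m w ≈ₚ id →
                 ∃ λ rest → IsCycle w (0F ∷ rest)
  sorted⇒cycle zero w w≈id =
    [] , ([] ∷ []) , λ x → trans (w≈id x) (sym (cycleFun-singleton 0F x))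
  sorted⇒cycle (suc m) w sorted = T-reflects-cycle w (sorted⇒cycle m (T w) Tw-sorted)
    where
    Tw-sorted : iterate T m (T w) ≈ₚ id
    Tw-sorted x = trans (cong (_⟨$⟩ʳ x) (sym (iterate-suc′ T m w))) (sorted x)

  cycle⇒sorts : (w : Permutation′ (suc n)) (r : List (Fin (suc n))) →
                IsCycle w (0F ∷ r) → Sorts T w
  cycle⇒sorts w [] (_ , w≗cycle) = 0 , λ x → trans (w≗cycle x) (cycleFun-singleton 0F x)
  cycle⇒sorts w (b ∷ r) w-cycle =
    Sorts-step (cycle⇒sorts (T w) r (T-shortens-cycle w b r w-cycle))

proposition4 : (n : ℕ) (w : Permutation′ (suc n)) →
    Sorts T w ⇔ (∃ λ (rest : List (Fin (suc n))) → IsCycle w (Fin.zero ∷ rest))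
proposition4 n w = mk⇔ (λ (m , sorted) → sorted⇒cycle m w sorted)
                       (λ (r , w-cycle) → cycle⇒sorts w r w-cycle)
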